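{- Let $t,u\in\mathrm{FPT}$. Then: (1) $t\prec u$ if and only if $t^+\to_\eta u^+$ (one step of $\eta$-reduction); (2) $t\le u$ if and only if $t^+\twoheadrightarrow_\eta u^+$.
   Context: A tree is a nonempty prefix-closed finitely branching set $A\subseteq(\mathbb N^+)^*$ with $wj\in A$, $i<j$ implying $wi\in A$. A permutation tree is a map $t:A\to\mathrm{Sym}(\mathbb N^+)$ such that a node with exactly $n$ children has label in $S_n$ (permutations of $\mathbb N^+$ fixing all $i>n$). Write $t=\langle\pi;t_1,\dots,t_n\rangle$; $\bar\epsilon$ is the one-node tree. $\mathrm{FPT}$ is the set of finite permutation trees. Product: $t\bar\epsilon=t=\bar\epsilon t$; for $t=\langle\pi;t_1..t_n\rangle$, $u=\langle\rho;u_1..u_m\rangle$: if $n\ge m$, $tu=\langle\pi\circ\rho;u_1t_{\rho1},..,u_mt_{\rho m},t_{m+1},..,t_n\rangle$; if $m\ge n$, $tu=\langle\pi\circ\rho;u_1t_{\rho1},..,u_mt_{\rho m}\rangle$ with $t_j:=\bar\epsilon$ for $j>n$. Inverse: $\bar\epsilon^*=\bar\epsilon$, $t^*=\langle\pi^{ -1};(t_{\pi^{ -1}1})^*,..,(t_{\pi^{ -1}n})^*\rangle$. Natural order: $t\le u$ iff $tt^*u=t$. $t\prec u$ means $t<u$ and there is no $z$ with $t<z<u$. For $t\in\mathrm{FPT}$, $t^+$ is the $\beta$-normal $\lambda$-term with $\bar\epsilon^+=\lambda x.x$ and $\langle\pi;t_1,..,t_n\rangle^+=$ the $\beta$-normal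 form of $\lambda xx_1..x_n.x((t_1)^+x_{\pi1})\cdots((t_n)^+x_{\pi n})$ (terms up to $\alpha$-renaming). -}

module Defs where

open import Data.Nat using (ℕ; zero; suc; _+_; _∸_; _≤_; _<_; _⊔_; _<?_)
open import Data.Nat.Properties
  using (≮⇒≥; ⊔-lub; m≤m⊔n; m≤n⊔m; <-≤-trans; ≤-trans; <-irrefl; ≤-<-trans)
open import Data.Fin using (Fin; toℕ; fromℕ<) renaming (zero to fzero; suc to fsuc)
open import Data.Fin.Properties using (toℕ<n)
open import Data.Product using (Σ; _×_; _,_)
open import Data.Empty using (⊥; ⊥-elim)
open import Relation.Nullary using (¬_; yes; no)
open import Relation.Binary.PropositionalEquality
  using (_≡_; refl; sym; trans; cong; subst)
open import Relation.Binary.Construct.Closure.ReflexiveTransitive using (Star)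
open import Function.Bundles using (_↔_; Inverse)
open import Function.Construct.Composition using (_↔-∘_)
open import Function.Construct.Symmetry using (↔-sym)
open import Function.Construct.Identity using (↔-id)

-- Conventions: positions/labels are 0-based, i.e. child number j ∈ ℕ⁺
-- of the paper is index j-1 here; Sym(ℕ⁺) is rendered as ℕ ↔ ℕ.

Fixes≥ : ℕ → ℕ ↔ ℕ → Set
Fixes≥ n π = ∀ i → n ≤ i → Inverse.to π i ≡ i

data FPT : Set where
  node : (n : ℕ) (π : ℕ ↔ ℕ) → Fixes≥ n π → (Fin n → FPT) → FPT

ε̄ : FPT
ε̄ = node 0 (↔-id ℕ) (λ _ _ → refl) (λ ())

infix 4 _≈_
data _≈_ : FPT → FPT → Set where
  node≈ : ∀ {n π π' p p' ts ts'} →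
          (∀ i → Inverse.to π i ≡ Inverse.to π' i) →
          (∀ i → ts i ≈ ts' i) →
          node n π p ts ≈ node n π' p' ts'

private
  <⊔-right : ∀ {i n m} → i < n ⊔ m → ¬ (i < m) → i < n
  <⊔-right {i} {n} {m} i<nm i≮m with i <? n
  ... | yes i<n = i<n
  ... | no  i≮n = ⊥-elim (<-irrefl refl
                    (<-≤-trans i<nm (⊔-lub (≮⇒≥ i≮n) (≮⇒≥ i≮m))))

  fix-∘ : ∀ {n m} (π ρ : ℕ ↔ ℕ) → Fixes≥ n π → Fixes≥ m ρ →
          Fixes≥ (n ⊔ m) (π ↔-∘ ρ)
  fix-∘ {n} {m} π ρ p q i nm≤i =
    trans (cong (Inverse.to π) (q i (≤-trans (m≤n⊔m n m) nm≤i)))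
          (p i (≤-trans (m≤m⊔n n m) nm≤i))

  fix-sym : ∀ {n} (π : ℕ ↔ ℕ) → Fixes≥ n π → Fixes≥ n (↔-sym π)
  fix-sym π p i n≤i =
    trans (cong (Inverse.from π) (sym (p i n≤i))) (Inverse.strictlyInverseʳ π i)

  from-< : ∀ {n} (π : ℕ ↔ ℕ) → Fixes≥ n π → ∀ i → i < n → Inverse.from π i < n
  from-< {n} π p i i<n with Inverse.from π i <? n
  ... | yes j<n = j<n
  ... | no  j≮n = ⊥-elim (<-irrefl refl (≤-<-trans n≤i i<n))
    where
      j = Inverse.from π i
      j≡i : j ≡ i
      j≡i = trans (sym (p j (≮⇒≥ j≮n))) (Inverse.strictlyInverseˡ π i)
      n≤i : n ≤ i
      n≤i = subst (n ≤_) j≡i (≮⇒≥ j≮n)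

-- With t = ⟨π; t_1..t_n⟩, u = ⟨ρ; u_1..u_m⟩, both cases of the
-- paper's definition are: tu = ⟨π∘ρ; c_1, …, c_{max(n,m)}⟩ where
--   c_i = u_i t_{ρ i}   if i ≤ m and ρ i ≤ n,
--   c_i = u_i           if i ≤ m and ρ i > n   (t_{ρ i} := ε̄, u ε̄ = u),
--   c_i = t_i           if i > m               (then i ≤ n).

infixl 7 _·_
_·_ : FPT → FPT → FPT
node n π p ts · node m ρ q us =
  node (n ⊔ m) (π ↔-∘ ρ) (fix-∘ π ρ p q) child
  where
    child : Fin (n ⊔ m) → FPT
    child i with toℕ i <? m
    ... | no  i≮m = ts (fromℕ< (<⊔-right (toℕ<n i) i≮m))
    ... | yes i<m with Inverse.to ρ (toℕ i) <? n
    ...   | yes j<n = us (fromℕ< i<m) · ts (fromℕ< j<n)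
    ...   | no  _   = us (fromℕ< i<m)

_* : FPT → FPT
node n π p ts * =
  node n (↔-sym π) (fix-sym π p)
    (λ i → ts (fromℕ< (from-< π p (toℕ i) (toℕ<n i))) *)

-- Natural order and covering relation (t t* u parenthesised as (t t*) u;
-- the product is associative, so this is immaterial).

infix 4 _≤ₜ_ _<ₜ_ _≺_
infix 8 _*

_≤ₜ_ : FPT → FPT → Set
t ≤ₜ u = (t · (t *)) · u ≈ t

_<ₜ_ : FPT → FPT → Set
t <ₜ u = t ≤ₜ u × ¬ (t ≈ u)

_≺_ : FPT → FPT → Set
t ≺ u = t <ₜ u × ¬ (Σ FPT λ z → t <ₜ z × z <ₜ u)

-- Untyped λ-terms, de Bruijn indices (= terms up to α-renaming).

data Term : Set where
  var : ℕ → Term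
  lam : Term → Term
  app : Term → Term → Term

shift : ℕ → Term → Term
shift c (var k) with k <? c
... | yes _ = var k
... | no  _ = var (suc k)
shift c (lam M)   = lam (shift (suc c) M)
shift c (app M N) = app (shift c M) (shift c N)

-- one step of η-reduction (compatible closure of λx. M x → M, x ∉ FV(M))
infix 4 _→η_
data _→η_ : Term → Term → Set where
  η    : ∀ {M} → lam (app (shift 0 M) (var 0)) →η M
  ξ    : ∀ {M M'} → M →η M' → lam M →η lam M'
  appˡ : ∀ {M M' N} → M →η M' → app M N →η app M' N
  appʳ : ∀ {M N N'} → N →η N' → app M N →η app M N'

infix 4 _↠η_
_↠η_ : Term → Term → Set
_↠η_ = Star _→η_

lams : ℕ → Term → Term
lams zero    M = M
lams (suc n) M = lam (lams n M)

apps : Term → (n : ℕ) → (Fin n → Term) → Term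
apps h zero    f = h
apps h (suc n) f = apps (app h (f fzero)) n (λ i → f (fsuc i))

-- nfApp t v is the β-normal form of  t⁺ v  (v a de Bruijn variable):
--   ⟨π; t_1..t_n⟩⁺ v  ↠β  λx_1..x_n. v (t_1⁺ x_{π1}) ⋯ (t_n⁺ x_{πn})
-- and recursively each (t_i⁺ x_{πi}) is normalised the same way.
-- Under the n binders x_1..x_n, x_j (0-based j) has index n ∸ 1 ∸ j and
-- v has index v + n.
nfApp : FPT → ℕ → Term
nfApp (node n π p ts) v =
  lams n (apps (var (v + n)) n
    (λ i → nfApp (ts i) (n ∸ 1 ∸ Inverse.to π (toℕ i))))

_⁺ : FPT → Term
t ⁺ = lam (nfApp t 0)

-- The natural order is structural: t ≤ u iff u is t pruned, i.e. arity u ≤ arity t, t and u carry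
-- the same label, and every child of t lies below the child of u at the same position (below ε̄ past
-- the arity of u).  This is shown by simultaneous induction with the mirror characterisation
-- u t* t = t, because the children of t t* u have exactly that shape.  On terms, a child of t that
-- is pruned away sits at a fixed position k and η-reduces to the bare variable x_k, so the last
-- binder of t⁺ becomes an η-redex; conversely every η-step of t⁺ deletes such a child somewhere.
-- Each η-step shrinks a term by 3, so t ≺ u exactly when t⁺ reaches u⁺ in one step.
module Submission where

open import Defs
open import Data.Product using (_×_; _,_; proj₁; proj₂; ∃-syntax)
open import Function.Bundles using (_⇔_; _↔_; Inverse; Equivalence; mk⇔)

open import Data.Empty using (⊥; ⊥-elim)
open import Data.Unit using (⊤; tt)
open import Data.Sum using (_⊎_; inj₁; inj₂)
open import Data.Nat using (ℕ; zero; suc; _+_; _∸_; _≤_; _<_; _⊔_; _<?_; _≤?_; z≤n; s≤s)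
open import Data.Nat.Properties
open import Data.Fin using (Fin; toℕ; fromℕ<; fromℕ; inject₁) renaming (zero to fzero; suc to fsuc)
open import Data.Fin.Properties using (toℕ<n; fromℕ<-toℕ; toℕ-fromℕ<; fromℕ<-cong; toℕ-inject₁; toℕ-fromℕ)
open import Data.Vec.Functional using (updateAt)
open import Function using (const; case_of_)
open import Function.Construct.Symmetry using (↔-sym)
open import Function.Construct.Composition using (_⇔-∘_)
open import Relation.Nullary using (¬_; yes; no; contradiction)
open import Relation.Binary.PropositionalEquality
open import Relation.Binary.Construct.Closure.ReflexiveTransitive using (ε; _◅_; _◅◅_; gmap)

open Inverse using (to; from)

arity : FPT → ℕ
arity (node n _ _ _) = n

label : FPT → ℕ → ℕ
label (node _ π _ _) = to π

label⁻¹ : FPT → ℕ → ℕ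
label⁻¹ (node _ π _ _) = from π

children : (t : FPT) → Fin (arity t) → FPT
children (node _ _ _ ts) = ts

-- Positions at or beyond the arity hold ε̄, matching the paper's convention t_j := ε̄ for j > n.
child : FPT → ℕ → FPT
child (node n _ _ ts) i with i <? n
... | yes i<n = ts (fromℕ< i<n)
... | no  _   = ε̄

child-< : ∀ t {i} (i<n : i < arity t) → child t i ≡ children t (fromℕ< i<n)
child-< (node n _ _ _) {i} i<n with i <? n
... | yes _   = refl
... | no  i≮n = contradiction i<n i≮n

child-≥ : ∀ t {i} → ¬ i < arity t → child t i ≡ ε̄
child-≥ (node n _ _ _) {i} i≮n with i <? n
... | yes i<n = contradiction i<n i≮n
... | no  _   = refl

child-toℕ : ∀ t (j : Fin (arity t)) → child t (toℕ j) ≡ children t j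
child-toℕ t j = trans (child-< t (toℕ<n j)) (cong (children t) (fromℕ<-toℕ j (toℕ<n j)))

≈-refl : ∀ t → t ≈ t
≈-refl (node _ _ _ ts) = node≈ (λ _ → refl) (λ i → ≈-refl (ts i))

≈-sym : ∀ {t u} → t ≈ u → u ≈ t
≈-sym (node≈ l c) = node≈ (λ i → sym (l i)) (λ i → ≈-sym (c i))

≈-trans : ∀ {t u v} → t ≈ u → u ≈ v → t ≈ v
≈-trans (node≈ l c) (node≈ l′ c′) = node≈ (λ i → trans (l i) (l′ i)) (λ i → ≈-trans (c i) (c′ i))

≈-reflexive : ∀ {t u} → t ≡ u → t ≈ u
≈-reflexive {t} refl = ≈-refl t

≈-arity : ∀ {t u} → t ≈ u → arity t ≡ arity u
≈-arity (node≈ _ _) = refl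

≈-label : ∀ {t u} → t ≈ u → ∀ i → label t i ≡ label u i
≈-label (node≈ l _) = l

≈-child : ∀ {t u} → t ≈ u → ∀ i → child t i ≈ child u i
≈-child (node≈ {n} _ c) i with i <? n
... | yes i<n = c (fromℕ< i<n)
... | no  _   = ≈-refl ε̄

≈-fromAccessors : ∀ {s t} → arity s ≡ arity t → (∀ i → label s i ≡ label t i) →
                  (∀ j → child s (toℕ j) ≈ children t j) → s ≈ t
≈-fromAccessors {s@(node _ _ _ _)} {node _ _ _ _} refl l c =
  node≈ l (λ j → ≈-trans (≈-reflexive (sym (child-toℕ s j))) (c j))

module _ {n} (π : ℕ ↔ ℕ) (fix : Fixes≥ n π) where

  from-fixes : ∀ i → n ≤ i → from π i ≡ i
  from-fixes i n≤i = trans (cong (from π) (sym (fix i n≤i))) (Inverse.strictlyInverseʳ π i)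

  -- A permutation fixing everything from n on cannot move i < n to some j ≥ n, since j is already the image of j.
  to-< : ∀ i → i < n → to π i < n
  to-< i i<n with to π i <? n
  ... | yes πi<n = πi<n
  ... | no  πi≮n = contradiction (subst (n ≤_) πi≡i (≮⇒≥ πi≮n)) (<⇒≱ i<n)
    where
    πi≡i : to π i ≡ i
    πi≡i = trans (sym (Inverse.strictlyInverseʳ π (to π i)))
                 (trans (cong (from π) (fix (to π i) (≮⇒≥ πi≮n))) (Inverse.strictlyInverseʳ π i))

from-< : ∀ {n} (π : ℕ ↔ ℕ) → Fixes≥ n π → ∀ i → i < n → from π i < n
from-< π fix = to-< (↔-sym π) (from-fixes π fix)

<⇒≤∸1 : ∀ {a n} → a < n → a ≤ n ∸ 1
<⇒≤∸1 {n = suc _} (s≤s a≤n) = a≤n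

Fixes≥-≗ : ∀ {n} π ρ → Fixes≥ n π → Fixes≥ n ρ →
           (∀ (j : Fin n) → to π (toℕ j) ≡ to ρ (toℕ j)) → ∀ i → to π i ≡ to ρ i
Fixes≥-≗ {n} π ρ p q eq i with n ≤? i
... | yes n≤i = trans (p i n≤i) (sym (q i n≤i))
... | no  n≰i = subst (λ k → to π k ≡ to ρ k) (toℕ-fromℕ< (≰⇒> n≰i)) (eq (fromℕ< (≰⇒> n≰i)))

<⊔-≮⇒< : ∀ {i} n {m} → i < n ⊔ m → ¬ i < m → i < n
<⊔-≮⇒< n {m} i<n⊔m i≮m = ≰⇒> (λ n≤i → <⇒≱ i<n⊔m (⊔-lub n≤i (≮⇒≥ i≮m)))

productChild : FPT → FPT → ℕ → FPT
productChild t u i with i <? arity u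
... | no  _ = child t i
... | yes _ with label u i <? arity t
...   | yes _ = child u i · child t (label u i)
...   | no  _ = child u i

children-· : ∀ t u (j : Fin (arity (t · u))) → children (t · u) j ≡ productChild t u (toℕ j)
children-· t@(node n π p ts) u@(node m ρ q us) j with toℕ j <? m
... | no  j≮m = sym (child-< t (<⊔-≮⇒< n (toℕ<n j) j≮m))
... | yes j<m with to ρ (toℕ j) <? n
...   | yes ρj<n = sym (cong₂ _·_ (child-< u j<m) (child-< t ρj<n))
...   | no  _    = sym (child-< u j<m)

child-· : ∀ t u i → child (t · u) i ≡ productChild t u i
child-· t@(node n π p ts) u@(node m ρ q us) i with i <? n ⊔ m
... | yes i<n⊔m = trans (children-· t u (fromℕ< i<n⊔m)) (cong (productChild t u) (toℕ-fromℕ< i<n⊔m))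
... | no  i≮n⊔m with i <? m
...   | yes i<m = contradiction (<-≤-trans i<m (m≤n⊔m n m)) i≮n⊔m
...   | no  _   = sym (child-≥ t (λ i<n → i≮n⊔m (<-≤-trans i<n (m≤m⊔n n m))))

child-·-inner : ∀ t u {i} → i < arity u → label u i < arity t →
                child (t · u) i ≡ child u i · child t (label u i)
child-·-inner t u {i} i<m ρi<n with i <? arity u | child-· t u i
... | no  i≮m | _  = contradiction i<m i≮m
... | yes _   | eq with label u i <? arity t
...   | yes _     = eq
...   | no  ρi≮n  = contradiction ρi<n ρi≮n

child-·-outer : ∀ t u {i} → i < arity u → ¬ label u i < arity t → child (t · u) i ≡ child u i
child-·-outer t u {i} i<m ρi≮n with i <? arity u | child-· t u i
... | no  i≮m | _  = contradiction i<m i≮m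
... | yes _   | eq with label u i <? arity t
...   | yes ρi<n  = contradiction ρi<n ρi≮n
...   | no  _     = eq

child-·-beyond : ∀ t u {i} → ¬ i < arity u → child (t · u) i ≡ child t i
child-·-beyond t u {i} i≮m with i <? arity u | child-· t u i
... | no  _   | eq = eq
... | yes i<m | _  = contradiction i<m i≮m

·-identityˡ : ∀ t → ε̄ · t ≈ t
·-identityˡ t@(node _ _ _ _) =
  ≈-fromAccessors refl (λ _ → refl) (λ j →
    ≈-reflexive (trans (child-·-outer ε̄ t (toℕ<n j) (λ ())) (child-toℕ t j)))

·-identityʳ : ∀ t → t · ε̄ ≈ t
·-identityʳ t@(node n _ _ _) =
  ≈-fromAccessors (⊔-identityʳ n) (λ _ → refl) (λ j →
    ≈-reflexive (trans (child-·-beyond t ε̄ (λ ())) (child-toℕ t j)))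

child-* : ∀ t {i} → i < arity t → child (t *) i ≡ child t (label⁻¹ t i) *
child-* t@(node n π p ts) {i} i<n =
  trans (child-< (t *) i<n)
    (trans (cong (λ k → ts k *) (fromℕ<-cong _ _ (cong (from π) (toℕ-fromℕ< i<n)) _ πi<n))
           (cong _* (sym (child-< t πi<n))))
  where πi<n = from-< π p i i<n

child-·* : ∀ t {i} → i < arity t → child (t · t *) i ≡ child t (label⁻¹ t i) * · child t (label⁻¹ t i)
child-·* t@(node n π p ts) {i} i<n =
  trans (child-·-inner t (t *) i<n (from-< π p i i<n)) (cong (_· child t (from π i)) (child-* t i<n))

child-*· : ∀ t {i} → i < arity t → child (t * · t) i ≡ child t i · child t i *
child-*· t@(node n π p ts) {i} i<n =
  trans (child-·-inner (t *) t i<n (to-< π p i i<n))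
        (cong (child t i ·_) (trans (child-* t (to-< π p i i<n))
                                    (cong (λ k → child t k *) (Inverse.strictlyInverseʳ π i))))

infix 4 _⊑_ _≤ʳ_

data _⊑_ : FPT → FPT → Set where
  node⊑ : ∀ {n m π ρ p q ts us} → m ≤ n → (∀ i → to π i ≡ to ρ i) →
          (∀ j → ts j ⊑ child (node m ρ q us) (toℕ j)) →
          node n π p ts ⊑ node m ρ q us

-- The mirror image of t ≤ₜ u; the children of t t* u are related to those of t and u in this form.
_≤ʳ_ : FPT → FPT → Set
t ≤ʳ u = u · (t * · t) ≈ t

child-tt*-label : ∀ t (j : Fin (arity t)) → child (t · t *) (label t (toℕ j)) ≡ children t j * · children t j
child-tt*-label t@(node n π p ts) j = begin
  child (t · t *) (to π i)
    ≡⟨ child-·* t (to-< π p i (toℕ<n j)) ⟩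
  child t (from π (to π i)) * · child t (from π (to π i))
    ≡⟨ cong (λ k → child t k * · child t k) (Inverse.strictlyInverseʳ π i) ⟩
  child t i * · child t i
    ≡⟨ cong (λ s → s * · s) (child-toℕ t j) ⟩
  ts j * · ts j
    ∎
  where
  open ≡-Reasoning
  i = toℕ j

child-t*t-toℕ : ∀ t (j : Fin (arity t)) → child (t * · t) (toℕ j) ≡ children t j · children t j *
child-t*t-toℕ t j = trans (child-*· t (toℕ<n j)) (cong (λ s → s · s *) (child-toℕ t j))

child-tt*u : ∀ {t u} → arity u ≤ arity t → (∀ i → label t i ≡ label u i) →
             ∀ j → child ((t · t *) · u) (toℕ j) ≈ child u (toℕ j) · (children t j * · children t j)
child-tt*u {t@(node n π p ts)} {u@(node m ρ q us)} m≤n π≗ρ j = case m ≤? i of λ where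
    (no  m≰i) → ≈-reflexive (trans (child-·-inner (t · t *) u (≰⇒> m≰i) (ρi<n⊔n (≰⇒> m≰i)))
                                   (cong (child u i ·_) tt*-at-ρi))
    (yes m≤i) → ≈-trans (≈-reflexive (trans (child-·-beyond (t · t *) u (≤⇒≯ m≤i))
                                             (trans (cong (child (t · t *)) (sym (q i m≤i))) tt*-at-ρi)))
                        (≈-sym (≈-trans (≈-reflexive (cong (_· _) (child-≥ u (≤⇒≯ m≤i)))) (·-identityˡ _)))
  where
  i = toℕ j
  ρi<n⊔n : i < m → to ρ i < n ⊔ n
  ρi<n⊔n i<m = <-≤-trans (to-< ρ q i i<m) (≤-trans m≤n (m≤m⊔n n n))
  tt*-at-ρi : child (t · t *) (to ρ i) ≡ ts j * · ts j
  tt*-at-ρi = trans (cong (child (t · t *)) (sym (π≗ρ i))) (child-tt*-label t j)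

child-ut*t : ∀ t u j → child (u · (t * · t)) (toℕ j) ≈ (children t j · children t j *) · child u (toℕ j)
child-ut*t t@(node n π p ts) u@(node m ρ q us) j = case m ≤? i of λ where
    (no  m≰i) → ≈-reflexive (trans (child-·-inner u (t * · t) j<n⊔n (subst (_< m) (sym (π⁻¹π i)) (≰⇒> m≰i)))
                                   (cong₂ _·_ (child-t*t-toℕ t j) (cong (child u) (π⁻¹π i))))
    (yes m≤i) → ≈-trans (≈-reflexive (trans (child-·-outer u (t * · t) j<n⊔n
                                                               (≤⇒≯ (subst (m ≤_) (sym (π⁻¹π i)) m≤i)))
                                             (child-t*t-toℕ t j)))
                        (≈-sym (≈-trans (≈-reflexive (cong (_ ·_) (child-≥ u (≤⇒≯ m≤i)))) (·-identityʳ _)))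
  where
  i = toℕ j
  π⁻¹π = Inverse.strictlyInverseʳ π
  j<n⊔n = <-≤-trans (toℕ<n j) (m≤m⊔n n n)

mutual
  ≤ₜ⇒⊑ : ∀ {t u} → t ≤ₜ u → t ⊑ u
  ≤ₜ⇒⊑ {t@(node n π p ts)} {u@(node m ρ q us)} h =
    node⊑ m≤n π≗ρ (λ j → ≤ʳ⇒⊑ (≈-trans (≈-sym (child-tt*u {t} {u} m≤n π≗ρ j))
                                       (≈-trans (≈-child h (toℕ j)) (≈-reflexive (child-toℕ t j)))))
    where
    m≤n : m ≤ n
    m≤n = subst (m ≤_) (≈-arity h) (m≤n⊔m (n ⊔ n) m)
    π≗ρ : ∀ i → to π i ≡ to ρ i
    π≗ρ i = trans (sym (≈-label h i)) (Inverse.strictlyInverseˡ π (to ρ i))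

  ≤ʳ⇒⊑ : ∀ {t u} → t ≤ʳ u → t ⊑ u
  ≤ʳ⇒⊑ {t@(node n π p ts)} {u@(node m ρ q us)} h =
    node⊑ m≤n π≗ρ (λ j → ≤ₜ⇒⊑ (≈-trans (≈-sym (child-ut*t t u j))
                                       (≈-trans (≈-child h (toℕ j)) (≈-reflexive (child-toℕ t j)))))
    where
    m≤n : m ≤ n
    m≤n = subst (m ≤_) (≈-arity h) (m≤m⊔n m (n ⊔ n))
    π≗ρ : ∀ i → to π i ≡ to ρ i
    π≗ρ i = trans (sym (≈-label h i)) (cong (to ρ) (Inverse.strictlyInverseʳ π i))

mutual
  ⊑⇒≤ₜ : ∀ {t u} → t ⊑ u → t ≤ₜ u
  ⊑⇒≤ₜ {t@(node n π p ts)} {u@(node m ρ q us)} (node⊑ m≤n π≗ρ c) =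
    ≈-fromAccessors (trans (cong (_⊔ m) (⊔-idem n)) (m≥n⇒m⊔n≡m m≤n))
                    (λ i → trans (Inverse.strictlyInverseˡ π (to ρ i)) (sym (π≗ρ i)))
                    (λ j → ≈-trans (child-tt*u {t} {u} m≤n π≗ρ j) (⊑⇒≤ʳ (c j)))

  ⊑⇒≤ʳ : ∀ {t u} → t ⊑ u → t ≤ʳ u
  ⊑⇒≤ʳ {t@(node n π p ts)} {u@(node m ρ q us)} (node⊑ m≤n π≗ρ c) =
    ≈-fromAccessors (trans (cong (m ⊔_) (⊔-idem n)) (m≤n⇒m⊔n≡n m≤n))
                    (λ i → trans (cong (to ρ) (Inverse.strictlyInverseʳ π i)) (sym (π≗ρ i)))
                    (λ j → ≈-trans (child-ut*t t u j) (⊑⇒≤ₜ (c j)))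

≤ₜ⇔⊑ : ∀ {t u} → (t ≤ₜ u) ⇔ (t ⊑ u)
≤ₜ⇔⊑ = mk⇔ ≤ₜ⇒⊑ ⊑⇒≤ₜ

⊑-child : ∀ {t u} → t ⊑ u → ∀ i → child t i ⊑ child u i
⊑-child {u = u} (node⊑ {n} {ts = ts} m≤n _ c) i with i <? n
... | yes i<n = subst (λ k → ts (fromℕ< i<n) ⊑ child u k) (toℕ-fromℕ< i<n) (c (fromℕ< i<n))
... | no  i≮n = subst (ε̄ ⊑_) (sym (child-≥ u (λ i<m → i≮n (<-≤-trans i<m m≤n)))) ε̄⊑ε̄
  where ε̄⊑ε̄ = node⊑ z≤n (λ _ → refl) (λ ())

⊑-trans : ∀ {s t u} → s ⊑ t → t ⊑ u → s ⊑ u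
⊑-trans (node⊑ m≤n π≗ρ c) t⊑u@(node⊑ k≤m ρ≗σ _) =
  node⊑ (≤-trans k≤m m≤n) (λ i → trans (π≗ρ i) (ρ≗σ i)) (λ j → ⊑-trans (c j) (⊑-child t⊑u (toℕ j)))

≈⇒⊑ : ∀ {t u} → t ≈ u → t ⊑ u
≈⇒⊑ {u = u} (node≈ π≗ρ c) =
  node⊑ ≤-refl π≗ρ (λ j → ≈⇒⊑ (≈-trans (c j) (≈-reflexive (sym (child-toℕ u j)))))

⊑-refl : ∀ t → t ⊑ t
⊑-refl t = ≈⇒⊑ (≈-refl t)

⊑-intro : ∀ {n m π ρ p q ts us} → m ≤ n → (∀ i → to π i ≡ to ρ i) →
          (∀ i → i < n → child (node n π p ts) i ⊑ child (node m ρ q us) i) → node n π p ts ⊑ node m ρ q us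
⊑-intro {n} {π = π} {p = p} {ts = ts} m≤n π≗ρ c =
  node⊑ m≤n π≗ρ (λ j → subst (_⊑ _) (child-toℕ (node n π p ts) j) (c (toℕ j) (toℕ<n j)))

arity0⇒⊑ε̄ : ∀ {t} → arity t ≡ 0 → t ⊑ ε̄
arity0⇒⊑ε̄ {node zero π p _} refl = node⊑ z≤n (λ i → p i z≤n) (λ ())

size : Term → ℕ
size (var _)   = 1
size (lam M)   = suc (size M)
size (app M N) = suc (size M + size N)

size-shift : ∀ c M → size (shift c M) ≡ size M
size-shift c (var k) with k <? c
... | yes _ = refl
... | no  _ = refl
size-shift c (lam M)   = cong suc (size-shift (suc c) M)
size-shift c (app M N) = cong suc (cong₂ _+_ (size-shift c M) (size-shift c N))

→η-size : ∀ {M N} → M →η N → size M ≡ 3 + size N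
→η-size (η {M})          = cong (2 +_) (trans (cong (_+ 1) (size-shift 0 M)) (+-comm (size M) 1))
→η-size (ξ s)            = cong suc (→η-size s)
→η-size (appˡ {N = N} s) = cong (λ k → suc (k + size N)) (→η-size s)
→η-size (appʳ {M} {N' = N′} s) = cong suc (begin
  size M + size _         ≡⟨ cong (size M +_) (→η-size s) ⟩
  size M + (3 + size N′)  ≡⟨ sym (+-assoc (size M) 3 (size N′)) ⟩
  size M + 3 + size N′    ≡⟨ cong (_+ size N′) (+-comm (size M) 3) ⟩
  3 + size M + size N′    ∎)
  where open ≡-Reasoning

→η-shrinks : ∀ {M N} → M →η N → 3 + size N ≤ size M
→η-shrinks s = ≤-reflexive (sym (→η-size s))

↠η-size : ∀ {M N} → M ↠η N → size N ≤ size M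
↠η-size ε        = ≤-refl
↠η-size (s ◅ ss) = ≤-trans (↠η-size ss) (≤-trans (m≤n+m _ 3) (→η-shrinks s))

↠η-uncons : ∀ {M N} → M ↠η N → M ≡ N ⊎ ∃[ M′ ] (M →η M′ × M′ ↠η N)
↠η-uncons ε        = inj₁ refl
↠η-uncons (s ◅ ss) = inj₂ (_ , s , ss)

↠η-≡⊎shrinks : ∀ {M N} → M ↠η N → M ≡ N ⊎ 3 + size N ≤ size M
↠η-≡⊎shrinks ε        = inj₁ refl
↠η-≡⊎shrinks (s ◅ ss) = inj₂ (≤-trans (+-monoʳ-≤ 3 (↠η-size ss)) (→η-shrinks s))

NotLam : Term → Set
NotLam (lam _) = ⊥
NotLam _       = ⊤

apps-notLam : ∀ h n f → NotLam h → NotLam (apps h n f)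
apps-notLam h zero    f nl = nl
apps-notLam h (suc n) f nl = apps-notLam (app h (f fzero)) n _ tt

lam-injective : ∀ {M N} → lam M ≡ lam N → M ≡ N
lam-injective refl = refl

app-injective : ∀ {M M′ N N′} → app M N ≡ app M′ N′ → M ≡ M′ × N ≡ N′
app-injective refl = refl , refl

var-injective : ∀ {k l} → var k ≡ var l → k ≡ l
var-injective refl = refl

lams-injective : ∀ {n m M N} → NotLam M → NotLam N → lams n M ≡ lams m N → n ≡ m × M ≡ N
lams-injective {zero}  {zero}  _   _   eq   = refl , eq
lams-injective {zero}  {suc _} nlM _   refl = ⊥-elim nlM
lams-injective {suc _} {zero}  _   nlN refl = ⊥-elim nlN
lams-injective {suc n} {suc m} nlM nlN eq =
  let n≡m , M≡N = lams-injective {n} {m} nlM nlN (lam-injective eq) in cong suc n≡m , M≡N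

apps-injective : ∀ {h h′} n {f g : Fin n → Term} → apps h n f ≡ apps h′ n g → h ≡ h′ × (∀ i → f i ≡ g i)
apps-injective zero eq = eq , λ ()
apps-injective (suc n) eq with apps-injective n eq
... | happ , rest = proj₁ (app-injective happ) , λ { fzero → proj₂ (app-injective happ) ; (fsuc i) → rest i }

apps-cong : ∀ h n {f g : Fin n → Term} → (∀ i → f i ≡ g i) → apps h n f ≡ apps h n g
apps-cong h zero    eq = refl
apps-cong h (suc n) eq = trans (cong (λ x → apps (app h x) n _) (eq fzero)) (apps-cong _ n (λ i → eq (fsuc i)))

apps-snoc : ∀ h k (f : Fin (suc k) → Term) → apps h (suc k) f ≡ app (apps h k (λ i → f (inject₁ i))) (f (fromℕ k))
apps-snoc h zero    f = refl
apps-snoc h (suc k) f = apps-snoc (app h (f fzero)) k (λ i → f (fsuc i))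

lams-suc : ∀ k M → lams (suc k) M ≡ lams k (lam M)
lams-suc zero    M = refl
lams-suc (suc k) M = cong lam (lams-suc k M)

lams-→η : ∀ n {M N} → M →η N → lams n M →η lams n N
lams-→η zero    s = s
lams-→η (suc n) s = ξ (lams-→η n s)

lams-↠η : ∀ n {M N} → M ↠η N → lams n M ↠η lams n N
lams-↠η n = gmap (lams n) (lams-→η n)

apps-head-↠η : ∀ n (f : Fin n → Term) {h h′} → h ↠η h′ → apps h n f ↠η apps h′ n f
apps-head-↠η n f = gmap (λ h → apps h n f) (step n f)
  where
  step : ∀ n (f : Fin n → Term) {h h′} → h →η h′ → apps h n f →η apps h′ n f
  step zero    f s = s
  step (suc n) f s = step n (λ i → f (fsuc i)) (appˡ s)

apps-args-↠η : ∀ h n {f g : Fin n → Term} → (∀ i → f i ↠η g i) → apps h n f ↠η apps h n g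
apps-args-↠η h zero    r = ε
apps-args-↠η h (suc n) r =
  apps-head-↠η n _ (gmap (app h) appʳ (r fzero)) ◅◅ apps-args-↠η _ n (λ i → r (fsuc i))

shiftIndex : ℕ → ℕ → ℕ
shiftIndex c k with k <? c
... | yes _ = k
... | no  _ = suc k

shift-var : ∀ c k → shift c (var k) ≡ var (shiftIndex c k)
shift-var c k with k <? c
... | yes _ = refl
... | no  _ = refl

shiftIndex-< : ∀ {c k} → k < c → shiftIndex c k ≡ k
shiftIndex-< {c} {k} k<c with k <? c
... | yes _   = refl
... | no  k≮c = contradiction k<c k≮c

shiftIndex-+ : ∀ c k n → shiftIndex (n + c) (k + n) ≡ shiftIndex c k + n
shiftIndex-+ c k n with k <? c | k + n <? n + c
... | yes _   | yes _     = refl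
... | no  _   | no  _     = refl
... | yes k<c | no  k+n≮  = contradiction (subst (k + n <_) (+-comm c n) (+-monoˡ-< n k<c)) k+n≮
... | no  k≮c | yes k+n<  = contradiction (+-cancelʳ-< n k c (subst (k + n <_) (+-comm n c) k+n<)) k≮c

shiftIndex-injective : ∀ c {k l} → shiftIndex c k ≡ shiftIndex c l → k ≡ l
shiftIndex-injective c {k} {l} eq with k <? c | l <? c
... | yes _   | yes _   = eq
... | no  _   | no  _   = suc-injective eq
... | yes k<c | no  l≮c = contradiction (<-trans (subst (l <_) (sym eq) (n<1+n l)) k<c) l≮c
... | no  k≮c | yes l<c = contradiction (<-trans (subst (k <_) eq (n<1+n k)) l<c) k≮c

shift-injective : ∀ c M N → shift c M ≡ shift c N → M ≡ N
shift-injective c (var k) (var l) eq =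
  cong var (shiftIndex-injective c (var-injective (trans (sym (shift-var c k)) (trans eq (shift-var c l)))))
shift-injective c (var k) (lam N) eq with () ← trans (sym (shift-var c k)) eq
shift-injective c (var k) (app N N′) eq with () ← trans (sym (shift-var c k)) eq
shift-injective c (lam M) (var l) eq with () ← trans eq (shift-var c l)
shift-injective c (app M M′) (var l) eq with () ← trans eq (shift-var c l)
shift-injective c (lam M) (lam N) eq = cong lam (shift-injective (suc c) M N (lam-injective eq))
shift-injective c (app M M′) (app N N′) eq =
  cong₂ app (shift-injective c M N (proj₁ (app-injective eq))) (shift-injective c M′ N′ (proj₂ (app-injective eq)))

shift-lams : ∀ c n M → shift c (lams n M) ≡ lams n (shift (n + c) M)
shift-lams c zero    M = refl
shift-lams c (suc n) M = cong lam (trans (shift-lams (suc c) n M) (cong (λ d → lams n (shift d M)) (+-suc n c)))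

shift-apps : ∀ c h n f → shift c (apps h n f) ≡ apps (shift c h) n (λ i → shift c (f i))
shift-apps c h zero    f = refl
shift-apps c h (suc n) f = shift-apps c (app h (f fzero)) n (λ i → f (fsuc i))

n∸1∸a<n : ∀ n a → Fin n → n ∸ 1 ∸ a < n
n∸1∸a<n (suc n) a _ = s≤s (m∸n≤m n a)

shift-nfApp : ∀ t c v → shift c (nfApp t v) ≡ nfApp t (shiftIndex c v)
shift-nfApp (node n π p ts) c v = begin
  shift c (nfApp (node n π p ts) v)
    ≡⟨ shift-lams c n _ ⟩
  lams n (shift (n + c) (apps (var (v + n)) n args))
    ≡⟨ cong (lams n) (shift-apps (n + c) (var (v + n)) n args) ⟩
  lams n (apps (shift (n + c) (var (v + n))) n (λ i → shift (n + c) (args i)))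
    ≡⟨ cong (λ h → lams n (apps h n _)) (trans (shift-var (n + c) (v + n)) (cong var (shiftIndex-+ c v n))) ⟩
  lams n (apps (var (shiftIndex c v + n)) n (λ i → shift (n + c) (args i)))
    ≡⟨ cong (lams n) (apps-cong _ n λ i →
         trans (shift-nfApp (ts i) (n + c) _)
               (cong (nfApp (ts i)) (shiftIndex-< (≤-trans (n∸1∸a<n n (to π (toℕ i)) i) (m≤m+n n c))))) ⟩
  nfApp (node n π p ts) (shiftIndex c v) ∎
  where
  open ≡-Reasoning
  args : Fin n → Term
  args i = nfApp (ts i) (n ∸ 1 ∸ to π (toℕ i))

nfApp-injective : ∀ t u {v w} → nfApp t v ≡ nfApp u w → t ≈ u × v ≡ w
nfApp-injective (node n π p ts) (node m ρ q us) {v} {w} eq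
  with lams-injective (apps-notLam (var (v + n)) n _ tt) (apps-notLam (var (w + m)) m _ tt) eq
... | refl , bodies with apps-injective n bodies
... | heads , args =
  node≈ (Fixes≥-≗ π ρ p q π≗ρ) (λ j → proj₁ (children≈ j)) , +-cancelʳ-≡ n v w (var-injective heads)
  where
  children≈ : ∀ j → ts j ≈ us j × n ∸ 1 ∸ to π (toℕ j) ≡ n ∸ 1 ∸ to ρ (toℕ j)
  children≈ j = nfApp-injective (ts j) (us j) (args j)
  π≗ρ : ∀ j → to π (toℕ j) ≡ to ρ (toℕ j)
  π≗ρ j = ∸-cancelˡ-≡ (<⇒≤∸1 (to-< π p _ (toℕ<n j))) (<⇒≤∸1 (to-< ρ q _ (toℕ<n j)))
                      (proj₂ (children≈ j))

nfApp-≈ : ∀ {t u} → t ≈ u → ∀ v → nfApp t v ≡ nfApp u v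
nfApp-≈ (node≈ {n} {ts' = us} π≗ρ c) v = cong (lams n) (apps-cong _ n λ i →
  trans (nfApp-≈ (c i) _) (cong (λ k → nfApp (us i) (n ∸ 1 ∸ k)) (π≗ρ (toℕ i))))

nfApp≡var : ∀ t {w x} → nfApp t w ≡ var x → arity t ≡ 0 × w ≡ x
nfApp≡var (node zero    _ _ _) {w} eq = refl , trans (sym (+-identityʳ w)) (var-injective eq)
nfApp≡var (node (suc _) _ _ _) ()

-- Body of nfApp of a node with children s and labels a, η-expanded (or truncated) to k arguments.
spine : ℕ → (ℕ → FPT) → (ℕ → ℕ) → ℕ → Term
spine v s a k = apps (var (v + k)) k (λ i → nfApp (s (toℕ i)) (k ∸ 1 ∸ a (toℕ i)))

spine-node : ∀ {n π p ts} v →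
             apps (var (v + n)) n (λ i → nfApp (ts i) (n ∸ 1 ∸ to π (toℕ i))) ≡ spine v (child (node n π p ts)) (to π) n
spine-node {n} {π} {p} {ts} v = apps-cong _ n (λ i → cong (λ s → nfApp s _) (sym (child-toℕ (node n π p ts) i)))

nfApp-spine : ∀ t v → nfApp t v ≡ lams (arity t) (spine v (child t) (label t) (arity t))
nfApp-spine (node n π p ts) v = cong (lams n) (spine-node {n} {π} {p} {ts} v)

spine-snoc : ∀ v s a k → spine v s a (suc k) ≡
             app (apps (var (v + suc k)) k (λ i → nfApp (s (toℕ i)) (k ∸ a (toℕ i)))) (nfApp (s k) (k ∸ a k))
spine-snoc v s a k = trans (apps-snoc _ k (λ i → nfApp (s (toℕ i)) (k ∸ a (toℕ i))))
  (cong₂ app (apps-cong _ k (λ i → cong (λ j → nfApp (s j) (k ∸ a j)) (toℕ-inject₁ i)))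
             (cong (λ j → nfApp (s j) (k ∸ a j)) (toℕ-fromℕ k)))

shift-spine : ∀ v s a k → (∀ i → i < k → a i < k) →
              shift 0 (spine v s a k) ≡ apps (var (v + suc k)) k (λ i → nfApp (s (toℕ i)) (k ∸ a (toℕ i)))
shift-spine v s a k a<k = begin
  shift 0 (spine v s a k)
    ≡⟨ shift-apps 0 (var (v + k)) k _ ⟩
  apps (var (suc (v + k))) k (λ i → shift 0 (nfApp (s (toℕ i)) (k ∸ 1 ∸ a (toℕ i))))
    ≡⟨ cong (λ x → apps (var x) k (λ i → shift 0 (nfApp (s (toℕ i)) (k ∸ 1 ∸ a (toℕ i))))) (sym (+-suc v k)) ⟩
  apps (var (v + suc k)) k (λ i → shift 0 (nfApp (s (toℕ i)) (k ∸ 1 ∸ a (toℕ i))))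
    ≡⟨ apps-cong _ k (λ i → trans (shift-nfApp (s (toℕ i)) 0 _)
                                  (cong (nfApp (s (toℕ i))) (suc[k∸1∸a]≡k∸a (a<k _ (toℕ<n i))))) ⟩
  apps (var (v + suc k)) k (λ i → nfApp (s (toℕ i)) (k ∸ a (toℕ i)))
    ∎
  where
  open ≡-Reasoning
  suc[k∸1∸a]≡k∸a : ∀ {a k} → a < k → suc (k ∸ 1 ∸ a) ≡ k ∸ a
  suc[k∸1∸a]≡k∸a {a} {suc k} (s≤s a≤k) = sym (+-∸-assoc 1 a≤k)

-- The hypothesis says that the first k arguments mention only the first k binders.
spine-η : ∀ v s a k → (∀ i → i < k → a i < k) →
          spine v s a (suc k) ≡ app (shift 0 (spine v s a k)) (nfApp (s k) (k ∸ a k))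
spine-η v s a k a<k = trans (spine-snoc v s a k) (cong (λ M → app M _) (sym (shift-spine v s a k a<k)))

nfApp-↠η : ∀ {t u} → t ⊑ u → ∀ v → nfApp t v ↠η nfApp u v
nfApp-↠η {node n π p ts} {u@(node m ρ q us)} (node⊑ m≤n π≗ρ c) v =
  children-↠η ◅◅ subst (λ k → expanded k ↠η expanded m) (m∸n+n≡m m≤n) (contract (n ∸ m))
              ◅◅ subst (expanded m ↠η_) (sym (nfApp-spine u v)) ε
  where
  expanded : ℕ → Term
  expanded k = lams k (spine v (child u) (to ρ) k)

  children-↠η : nfApp (node n π p ts) v ↠η expanded n
  children-↠η = lams-↠η n (apps-args-↠η _ n λ i →
    subst (λ k → nfApp (ts i) _ ↠η nfApp (child u (toℕ i)) (n ∸ 1 ∸ k)) (π≗ρ (toℕ i)) (nfApp-↠η (c i) _))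

  η-step : ∀ k → m ≤ k → expanded (suc k) →η expanded k
  η-step k m≤k = subst (_→η expanded k) (sym expanded-suc) (lams-→η k η)
    where
    last≡0 : nfApp (child u k) (k ∸ to ρ k) ≡ var 0
    last≡0 = cong₂ nfApp (child-≥ u (≤⇒≯ m≤k)) (trans (cong (k ∸_) (q k m≤k)) (n∸n≡0 k))
    expanded-suc : expanded (suc k) ≡ lams k (lam (app (shift 0 (spine v (child u) (to ρ) k)) (var 0)))
    expanded-suc = trans (lams-suc k _) (cong (λ M → lams k (lam M))
      (trans (spine-η v (child u) (to ρ) k (to-< ρ (λ i k≤i → q i (≤-trans m≤k k≤i)))) (cong (app _) last≡0)))

  contract : ∀ d → expanded (d + m) ↠η expanded m
  contract zero    = ε
  contract (suc d) = η-step (d + m) (m≤n+m m d) ◅ contract d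

lams-→η-inv : ∀ n {X M} → lams n X →η M →
              (∃[ X′ ] (X →η X′ × M ≡ lams n X′)) ⊎
              (∃[ k ] (n ≡ suc k × ∃[ M₀ ] (X ≡ app (shift 0 M₀) (var 0) × M ≡ lams k M₀)))
lams-→η-inv zero          s     = inj₁ (_ , s , refl)
lams-→η-inv (suc zero)    η     = inj₂ (0 , refl , _ , refl , refl)
lams-→η-inv (suc zero)    (ξ s) = inj₁ (_ , s , refl)
lams-→η-inv (suc (suc n)) (ξ s) with lams-→η-inv (suc n) s
... | inj₁ (X′ , s′ , refl)           = inj₁ (X′ , s′ , refl)
... | inj₂ (k , refl , M₀ , eq , refl) = inj₂ (suc k , refl , M₀ , eq , refl)

apps-→η-inv : ∀ h n (f : Fin n → Term) {M} → apps h n f →η M →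
              (∃[ h′ ] (h →η h′ × M ≡ apps h′ n f)) ⊎
              (∃[ j ] ∃[ N ] (f j →η N × M ≡ apps h n (updateAt f j (const N))))
apps-→η-inv h zero    f s = inj₁ (_ , s , refl)
apps-→η-inv h (suc n) f s with apps-→η-inv (app h (f fzero)) n (λ i → f (fsuc i)) s
... | inj₂ (j , N , sⱼ , refl)       = inj₂ (fsuc j , N , sⱼ , refl)
... | inj₁ (_ , appˡ s′ , refl)      = inj₁ (_ , s′ , refl)
... | inj₁ (_ , appʳ s′ , refl)      = inj₂ (fzero , _ , s′ , refl)

updateAt-map : ∀ {A B : Set} {n} (g : Fin n → A → B) (xs : Fin n → A) j x i →
               g i (updateAt xs j (const x) i) ≡ updateAt (λ k → g k (xs k)) j (const (g j x)) i
updateAt-map g xs fzero    x fzero    = refl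
updateAt-map g xs fzero    x (fsuc i) = refl
updateAt-map g xs (fsuc j) x fzero    = refl
updateAt-map g xs (fsuc j) x (fsuc i) = updateAt-map (λ k → g (fsuc k)) (λ k → xs (fsuc k)) j x i

updateAt-related : ∀ {A : Set} {R : A → A → Set} {n} (xs : Fin n → A) j {y} →
                   (∀ i → R (xs i) (xs i)) → R (xs j) y → ∀ i → R (xs i) (updateAt xs j (const y) i)
updateAt-related xs fzero    refl′ r fzero    = r
updateAt-related xs fzero    refl′ r (fsuc i) = refl′ (fsuc i)
updateAt-related xs (fsuc j) refl′ r fzero    = refl′ fzero
updateAt-related {R = R} xs (fsuc j) refl′ r (fsuc i) =
  updateAt-related {R = R} (λ k → xs (fsuc k)) j (λ k → refl′ (fsuc k)) r i

⊑-updateAt : ∀ {n π p ts} j {u} → ts j ⊑ u → node n π p ts ⊑ node n π p (updateAt ts j (const u))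
⊑-updateAt {n} {π} {p} {ts} j {u} tⱼ⊑u = node⊑ ≤-refl (λ _ → refl) λ i →
  subst (ts i ⊑_) (sym (child-toℕ (node n π p (updateAt ts j (const u))) i))
        (updateAt-related {R = _⊑_} ts j (λ k → ⊑-refl (ts k)) tⱼ⊑u i)

-- The last argument of the redex must be the bound variable itself, so the last child is a leaf whose position k is fixed.
nfApp-η-inv : ∀ {k π p ts v M₀} →
              apps (var (v + suc k)) (suc k) (λ i → nfApp (ts i) (k ∸ to π (toℕ i))) ≡ app (shift 0 M₀) (var 0) →
              ∃[ u ] (node (suc k) π p ts ⊑ u × lams k M₀ ≡ nfApp u v)
nfApp-η-inv {k} {π} {p} {ts} {v} {M₀} redex = u , t⊑u , cong (lams k) M₀≡spine
  where
  t = node (suc k) π p ts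

  split : app (apps (var (v + suc k)) k (λ i → nfApp (child t (toℕ i)) (k ∸ to π (toℕ i))))
              (nfApp (child t k) (k ∸ to π k)) ≡ app (shift 0 M₀) (var 0)
  split = trans (sym (spine-snoc v (child t) (to π) k)) (trans (sym (spine-node {suc k} {π} {p} {ts} v)) redex)

  lastLeaf : arity (child t k) ≡ 0 × k ∸ to π k ≡ 0
  lastLeaf = nfApp≡var (child t k) (proj₂ (app-injective split))

  πk≡k : to π k ≡ k
  πk≡k = ≤-antisym (m<1+n⇒m≤n (to-< π p k (n<1+n k))) (m∸n≡0⇒m≤n (proj₂ lastLeaf))

  fix : Fixes≥ k π
  fix i k≤i with m≤n⇒m<n∨m≡n k≤i
  ... | inj₁ k<i  = p i k<i
  ... | inj₂ refl = πk≡k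

  u : FPT
  u = node k π fix (λ j → child t (toℕ j))

  t⊑u : t ⊑ u
  t⊑u = ⊑-intro (n≤1+n k) (λ _ → refl) λ i i<1+k → case i <? k of λ where
    (yes i<k) → subst (child t i ⊑_) (sym (trans (child-< u i<k) (cong (child t) (toℕ-fromℕ< i<k)))) (⊑-refl (child t i))
    (no  i≮k) → subst (λ j → child t j ⊑ child u j) (≤-antisym (≮⇒≥ i≮k) (m<1+n⇒m≤n i<1+k))
                      (subst (child t k ⊑_) (sym (child-≥ u (n≮n k))) (arity0⇒⊑ε̄ (proj₁ lastLeaf)))

  M₀≡spine : M₀ ≡ spine v (child t) (to π) k
  M₀≡spine = shift-injective 0 M₀ _ (trans (sym (proj₁ (app-injective split)))
                                         (sym (shift-spine v (child t) (to π) k (to-< π fix))))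

nfApp-→η-inv : ∀ t v {M} → nfApp t v →η M → ∃[ u ] (t ⊑ u × M ≡ nfApp u v)
nfApp-→η-inv (node n π p ts) v s with lams-→η-inv n s
... | inj₁ (_ , s′ , refl) with apps-→η-inv (var (v + n)) n _ s′
...   | inj₁ (_ , () , _)
...   | inj₂ (j , _ , sⱼ , refl) with nfApp-→η-inv (ts j) _ sⱼ
...     | uⱼ , tⱼ⊑uⱼ , refl =
  node n π p (updateAt ts j (const uⱼ)) , ⊑-updateAt j tⱼ⊑uⱼ ,
  cong (lams n) (apps-cong _ n (λ i → sym (updateAt-map (λ k s → nfApp s (n ∸ 1 ∸ to π (toℕ k))) ts j uⱼ i)))
nfApp-→η-inv (node .(suc k) π p ts) v s | inj₂ (k , refl , M₀ , redex , refl) = nfApp-η-inv redex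

⁺-≈ : ∀ {t u} → t ≈ u → t ⁺ ≡ u ⁺
⁺-≈ t≈u = cong lam (nfApp-≈ t≈u 0)

⁺-injective : ∀ {t u} → t ⁺ ≡ u ⁺ → t ≈ u
⁺-injective {t} {u} eq = proj₁ (nfApp-injective t u (lam-injective eq))

nfApp≢app : ∀ t {v M N} → nfApp t v ≢ app M N
nfApp≢app (node zero    _ _ _) ()
nfApp≢app (node (suc _) _ _ _) ()

⁺-→η-inv : ∀ t {M} → t ⁺ →η M → ∃[ u ] (t ⊑ u × M ≡ u ⁺)
⁺-→η-inv t s with lams-→η-inv 1 s
... | inj₂ (_ , refl , _ , redex , refl) = ⊥-elim (nfApp≢app t redex)
... | inj₁ (_ , s′ , refl) with nfApp-→η-inv t 0 s′
...   | u , t⊑u , refl = u , t⊑u , refl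

⁺-↠η-inv : ∀ t {M} → t ⁺ ↠η M → ∃[ u ] (t ⊑ u × M ≡ u ⁺)
⁺-↠η-inv t ε = t , ⊑-refl t , refl
⁺-↠η-inv t (s ◅ ss) with ⁺-→η-inv t s
... | z , t⊑z , refl with ⁺-↠η-inv z ss
...   | u , z⊑u , eq = u , ⊑-trans t⊑z z⊑u , eq

⊑⇔⁺↠η : ∀ {t u} → (t ⊑ u) ⇔ (t ⁺ ↠η u ⁺)
⊑⇔⁺↠η {t} {u} = mk⇔ (λ t⊑u → gmap lam ξ (nfApp-↠η t⊑u 0)) ↠η⇒⊑
  where
  ↠η⇒⊑ : t ⁺ ↠η u ⁺ → t ⊑ u
  ↠η⇒⊑ r with ⁺-↠η-inv t r
  ... | u′ , t⊑u′ , u⁺≡u′⁺ = ⊑-trans t⊑u′ (≈⇒⊑ (⁺-injective (sym u⁺≡u′⁺)))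

≤ₜ⇔⁺↠η : ∀ {t u} → (t ≤ₜ u) ⇔ (t ⁺ ↠η u ⁺)
≤ₜ⇔⁺↠η = ⊑⇔⁺↠η ⇔-∘ ≤ₜ⇔⊑

n<3+n : ∀ n → n < 3 + n
n<3+n n = m<n+m n (s≤s z≤n)

shrinks⇒≉ : ∀ {t u} → 3 + size (u ⁺) ≤ size (t ⁺) → ¬ t ≈ u
shrinks⇒≉ {t} {u} shrinks t≈u =
  <-irrefl refl (<-≤-trans (n<3+n (size (u ⁺))) (subst (λ M → 3 + size (u ⁺) ≤ size M) (⁺-≈ t≈u) shrinks))

<ₜ⇒⁺-shrinks : ∀ {t u} → t <ₜ u → 3 + size (u ⁺) ≤ size (t ⁺)
<ₜ⇒⁺-shrinks (t≤u , t≉u) with ↠η-≡⊎shrinks (Equivalence.to ≤ₜ⇔⁺↠η t≤u)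
... | inj₁ t⁺≡u⁺ = ⊥-elim (t≉u (⁺-injective t⁺≡u⁺))
... | inj₂ shrinks = shrinks

→η⇒≺ : ∀ {t u} → t ⁺ →η u ⁺ → t ≺ u
→η⇒≺ {t} {u} s = (Equivalence.from ≤ₜ⇔⁺↠η (s ◅ ε) , shrinks⇒≉ (→η-shrinks s)) , noBetween
  where
  noBetween : ¬ (∃[ z ] (t <ₜ z × z <ₜ u))
  noBetween (z , t<z , z<u) = <-irrefl refl (begin-strict
    size (t ⁺)          ≡⟨ →η-size s ⟩
    3 + size (u ⁺)      <⟨ +-monoʳ-< 3 (<-≤-trans (n<3+n _) (<ₜ⇒⁺-shrinks z<u)) ⟩
    3 + size (z ⁺)      ≤⟨ <ₜ⇒⁺-shrinks t<z ⟩
    size (t ⁺)          ∎)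
    where open ≤-Reasoning

≺⇒→η : ∀ {t u} → t ≺ u → t ⁺ →η u ⁺
≺⇒→η {t} {u} ((t≤u , t≉u) , noBetween) with ↠η-uncons (Equivalence.to ≤ₜ⇔⁺↠η t≤u)
... | inj₁ t⁺≡u⁺ = ⊥-elim (t≉u (⁺-injective t⁺≡u⁺))
... | inj₂ (_ , s , r) with ⁺-→η-inv t s
...   | z , t⊑z , refl with ↠η-≡⊎shrinks r
...     | inj₁ z⁺≡u⁺  = subst (t ⁺ →η_) z⁺≡u⁺ s
...     | inj₂ shrinks = ⊥-elim (noBetween (z , (⊑⇒≤ₜ t⊑z , shrinks⇒≉ (→η-shrinks s))
                                              , (Equivalence.from ≤ₜ⇔⁺↠η r , shrinks⇒≉ shrinks)))

proposition4p9 : (t u : FPT) →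
    ((t ≺ u) ⇔ (t ⁺ →η u ⁺)) × ((t ≤ₜ u) ⇔ (t ⁺ ↠η u ⁺))
proposition4p9 t u = mk⇔ ≺⇒→η →η⇒≺ , ≤ₜ⇔⁺↠η
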